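{- Let $G$ be a finite abelian group. Then $\mathcal{G}_e(G)$ has a cone vertex if and only if $G$ has a cyclic Sylow $p$-subgroup for some prime $p$ dividing $|G|$.
   Context: For a group $G$, the enhanced power graph $\mathcal{G}_e(G)$ is the simple undirected graph with vertex set $G$ in which two distinct vertices $x,y$ are adjacent if there exists $z\in G$ with $x=z^m$ and $y=z^n$ for some $m,n\in\mathbb{N}$. A cone vertex of $\mathcal{G}_e(G)$ is a vertex other than the identity element that is adjacent to every other vertex. -}

module Defs where

open import Level using (Level; _⊔_)
open import Algebra.Bundles using (AbelianGroup)
open import Data.Nat using (ℕ; zero; suc; _^_)
open import Data.Nat.Divisibility using (_∣_)
open import Data.Nat.Primality using (Prime)
open import Data.Fin using (Fin)
open import Data.Product using (Σ; ∃; _×_; _,_; proj₁)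
open import Relation.Nullary using (¬_)
open import Relation.Binary.PropositionalEquality using (_≡_)

module _ {c ℓ : Level} (G : AbelianGroup c ℓ) where
  open AbelianGroup G

  pow : Carrier → ℕ → Carrier
  pow g zero    = ε
  pow g (suc k) = g ∙ pow g k

  HasOrder : ℕ → Set (c ⊔ ℓ)
  HasOrder n = Σ (Fin n → Carrier) λ f →
    (∀ i j → f i ≈ f j → i ≡ j) × (∀ x → ∃ λ i → f i ≈ x)

  -- adjacency in the enhanced power graph: distinct x, y with x = z^m, y = z^k, m,k ∈ ℕ = {1,2,...}
  EAdjacent : Carrier → Carrier → Set (c ⊔ ℓ)
  EAdjacent x y = ¬ (x ≈ y) × ∃ λ z → ∃ λ m → ∃ λ k →
    (x ≈ pow z (suc m)) × (y ≈ pow z (suc k))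

  IsConeVertex : Carrier → Set (c ⊔ ℓ)
  IsConeVertex x = ¬ (x ≈ ε) × (∀ y → ¬ (y ≈ x) → EAdjacent x y)

  record IsSubgroup (P : Carrier → Set (c ⊔ ℓ)) : Set (c ⊔ ℓ) where
    field
      resp  : ∀ {x y} → x ≈ y → P x → P y
      ε∈    : P ε
      ∙∈    : ∀ {x y} → P x → P y → P (x ∙ y)
      ⁻¹∈   : ∀ {x} → P x → P (x ⁻¹)

  HasSize : (Carrier → Set (c ⊔ ℓ)) → ℕ → Set (c ⊔ ℓ)
  HasSize P k = Σ (Fin k → Σ Carrier P) λ f →
    (∀ i j → proj₁ (f i) ≈ proj₁ (f j) → i ≡ j) × (∀ x → P x → ∃ λ i → proj₁ (f i) ≈ x)

  IsSylow : ℕ → ℕ → (Carrier → Set (c ⊔ ℓ)) → Set (c ⊔ ℓ)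
  IsSylow p n P = IsSubgroup P × ∃ λ a → HasSize P (p ^ a) × (p ^ a ∣ n) × ¬ (p ^ suc a ∣ n)

  IsCyclicSubgroup : (Carrier → Set (c ⊔ ℓ)) → Set (c ⊔ ℓ)
  IsCyclicSubgroup P = ∃ λ g → P g × (∀ h → P h → ∃ λ m → h ≈ pow g m)

module Submission where

-- A non-identity x is a cone vertex iff every y lies in a common cyclic subgroup with x.
-- If so, and p divides the order of x, the element x′ of order p in ⟨x⟩ inherits this property,
-- and since a cyclic group has at most one subgroup of order p, ⟨x′⟩ = Ω₁ = {w | w ↑ p ≈ ε}.
-- Conversely, if ⟨x⟩ = Ω₁ then every y is cocyclic with x: either p ∤ ord y and ⟨x ∙ y⟩
-- contains both, or ⟨y⟩ contains an element of order p, which then generates ⟨x⟩.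
-- Finally Ω₁ is cyclic exactly when the Sylow p-subgroup is: a cyclic p-group has cyclic Ω₁; if
-- Ω₁ = ⟨x⟩ ⊆ ⟨g⟩ with |⟨g⟩| = p ^ k still below the p-part of n, Cauchy's theorem in G/⟨g⟩
-- gives y ∉ ⟨g⟩ with y ↑ p ≈ g ↑ c; here p ∤ c, for otherwise y ∙ g ↑ (-c/p) ∈ Ω₁ ⊆ ⟨g⟩,
-- so ⟨y⟩ ⊇ ⟨g⟩ has order p ^ (k + 1).  Lagrange and Cauchy for G/H both come from
-- enumerating H⟨y⟩ as {y ↑ i ∙ h | i < relOrd H y, h ∈ H}.

open import Defs
open import Level using (Level; _⊔_; Lift; lift) renaming (suc to lsuc)
open import Algebra.Bundles using (AbelianGroup)
open import Data.Nat as ℕ using (ℕ; zero; suc; _+_; _*_; _^_; _<_; _≤_; z≤n; s≤s; NonZero; nonTrivial⇒n>1)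
import Data.Nat.Properties as ℕ
open import Data.Nat.DivMod using (_%_; _/_; m≡m%n+[m/n]*n; m%n<n)
open import Data.Nat.Divisibility
  using (_∣_; _∣?_; divides; 1∣_; ∣1⇒≡1; ∣-trans; ∣-reflexive; n∣m*n; ∣⇒≤; m%n≡0⇒n∣m;
         *-monoˡ-∣; *-cancelˡ-∣; *-cancelʳ-∣)
open import Data.Nat.Coprimality using (Coprime; coprime-divisor; coprime-Bézout; 0-coprimeTo-m⇒m≡1)
  renaming (sym to ⊥-sym)
open import Data.Nat.GCD using (module Bézout)
open import Data.Nat.Primality
  using (Prime; ¬prime[1]; euclidsLemma; prime⇒irreducible; prime⇒nonZero; prime⇒nonTrivial)
open import Data.Nat.Primality.Factorisation using (factorise)
open import Data.Nat.Induction using (<-rec)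
open import Data.Nat.ListAction using (product)
open import Data.List using (_∷_)
open import Data.List.Relation.Unary.All using (_∷_)
open import Data.Fin as Fin using (Fin; toℕ; fromℕ<; combine; remQuot)
import Data.Fin.Properties as Fin
open import Data.Product using (Σ; ∃; _×_; _,_; proj₁; proj₂)
open import Data.Sum using (inj₁; inj₂)
open import Function using (_∘_)
open import Function.Bundles using (_⇔_; mk⇔; Injection)
open import Function.Properties.Inverse using (↔⇒↣)
open import Relation.Nullary using (¬_; Dec; yes; no; contradiction)
import Relation.Unary as U
open import Relation.Binary.Definitions using (Decidable)
open import Relation.Binary.PropositionalEquality as ≡ using (_≡_)

prime⇒>1 : ∀ {p} → Prime p → 1 < p
prime⇒>1 {p} p-prime = nonTrivial⇒n>1 p {{prime⇒nonTrivial p-prime}}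

¬∣⇒coprime : ∀ {p m} → Prime p → ¬ p ∣ m → Coprime m p
¬∣⇒coprime p-prime p∤m (d∣m , d∣p) with prime⇒irreducible p-prime d∣p
... | inj₁ d≡1  = d≡1
... | inj₂ ≡.refl = contradiction d∣m p∤m

coprime-* : ∀ {m a b} → Coprime m a → Coprime m b → Coprime m (a * b)
coprime-* ma mb (d∣m , d∣ab) =
  mb (d∣m , coprime-divisor (λ (e∣d , e∣a) → ma (∣-trans e∣d d∣m , e∣a)) d∣ab)

coprime-^ : ∀ {m a} → Coprime m a → ∀ k → Coprime m (a ^ k)
coprime-^ _  zero    (_ , d∣1) = ∣1⇒≡1 d∣1
coprime-^ ma (suc k) = coprime-* ma (coprime-^ ma k)

p^suc∤p^ : ∀ {p} → Prime p → ∀ k → ¬ p ^ suc k ∣ p ^ k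
p^suc∤p^ {p} p-prime k p^suc∣p^ =
  ℕ.<-irrefl ≡.refl (ℕ.<-≤-trans p^k<p^suc (∣⇒≤ p^suc∣p^))
  where
  instance
    _ = ℕ.m^n≢0 p k {{prime⇒nonZero p-prime}}
  p^k<p^suc : p ^ k < p ^ suc k
  p^k<p^suc = ≡.subst (p ^ k <_) (ℕ.*-comm (p ^ k) p) (ℕ.m<m*n (p ^ k) p (prime⇒>1 p-prime))

∣p^suc∧∤p^⇒≡ : ∀ {p} → Prime p → ∀ k {d} → d ∣ p ^ suc k → ¬ d ∣ p ^ k → d ≡ p ^ suc k
∣p^suc∧∤p^⇒≡ {p} p-prime k {d} d∣p^suc d∤p^k with p ∣? d
... | no p∤d = contradiction (coprime-divisor (¬∣⇒coprime p-prime p∤d) d∣p^suc) d∤p^k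
... | yes (divides e ≡.refl) =
  ≡.trans (≡.cong (_* p) (quotient≡ k e∣p^k d∤p^k)) (ℕ.*-comm (p ^ k) p)
  where
  instance _ = prime⇒nonZero p-prime
  e∣p^k : e ∣ p ^ k
  e∣p^k = *-cancelʳ-∣ p (≡.subst (e * p ∣_) (ℕ.*-comm p (p ^ k)) d∣p^suc)
  quotient≡ : ∀ k {f} → f ∣ p ^ k → ¬ f * p ∣ p ^ k → f ≡ p ^ k
  quotient≡ zero    f∣1 _ = ∣1⇒≡1 f∣1
  quotient≡ (suc k) {f} f∣p^suc fp∤p^suc = ∣p^suc∧∤p^⇒≡ p-prime k f∣p^suc
    (λ f∣p^k → fp∤p^suc (≡.subst (f * p ∣_) (ℕ.*-comm (p ^ k) p) (*-monoˡ-∣ p f∣p^k)))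

exact-prime-power : ∀ {p} → Prime p → ∀ n .{{_ : NonZero n}} →
                    ∃ λ a → p ^ a ∣ n × ¬ p ^ suc a ∣ n
exact-prime-power {p} p-prime n = <-rec Exact exact n
  where
  instance _ = prime⇒nonZero p-prime
  Exact : ℕ → Set
  Exact n = .{{NonZero n}} → ∃ λ a → p ^ a ∣ n × ¬ p ^ suc a ∣ n
  exact : ∀ n → (∀ {m} → m < n → Exact m) → Exact n
  exact n rec with p ∣? n
  ... | no p∤n = 0 , 1∣ n , λ p^1∣n → p∤n (≡.subst (_∣ n) (ℕ.*-identityʳ p) p^1∣n)
  ... | yes (divides m ≡.refl) = one-more (rec (ℕ.m<m*n m p (prime⇒>1 p-prime)))
    where
    instance _ = ℕ.m*n≢0⇒m≢0 m
    one-more : (∃ λ a → p ^ a ∣ m × ¬ p ^ suc a ∣ m) →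
               ∃ λ a → p ^ a ∣ m * p × ¬ p ^ suc a ∣ m * p
    one-more (a , p^a∣m , p^suc∤m) =
      suc a , ≡.subst (_∣ m * p) (ℕ.*-comm (p ^ a) p) (*-monoˡ-∣ p p^a∣m) ,
      λ p^2+a∣mp → p^suc∤m (*-cancelʳ-∣ p (≡.subst (_∣ m * p) (ℕ.*-comm p (p ^ suc a)) p^2+a∣mp))

∃-prime-divisor : ∀ m → 1 < m → ∃ λ p → Prime p × p ∣ m
∃-prime-divisor 1 (s≤s ())
∃-prime-divisor m@(suc (suc _)) _ with factorise m
... | record { factors = p ∷ ps ; isFactorisation = m≡ ; factorsPrime = p-prime ∷ _ } =
  p , p-prime , divides (product ps) (≡.trans m≡ (ℕ.*-comm p (product ps)))

least-witness : ∀ {a} {Q : ℕ → Set a} → U.Decidable Q → ∀ N → Q N →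
                ∃ λ m → Q m × (∀ {k} → k < m → ¬ Q k)
least-witness Q? N qN with Q? 0
... | yes q0 = 0 , q0 , λ ()
least-witness Q? zero    q0 | no ¬q0 = contradiction q0 ¬q0
least-witness Q? (suc N) qN | no ¬q0 with least-witness (Q? ∘ suc) N qN
... | m , qm , below = suc m , qm , λ { {zero} _ → ¬q0 ; {suc k} (s≤s k<m) → below k<m }

module Powers {c ℓ : Level} (G : AbelianGroup c ℓ) where
  open AbelianGroup G
  open import Algebra.Properties.AbelianGroup G using (inverseʳ-unique; ⁻¹-involutive)
  open import Algebra.Properties.CommutativeMonoid.Mult commutativeMonoid
    using (×-congʳ; ×-homo-+; ×-assocˡ; ×-distrib-+)
    renaming (_×_ to _×ᵐ_)
  open import Relation.Binary.Reasoning.Setoid setoid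

  infixr 8 _↑_
  _↑_ : Carrier → ℕ → Carrier
  g ↑ t = pow G g t

  ↑≡× : ∀ g t → g ↑ t ≡ t ×ᵐ g
  ↑≡× g zero    = ≡.refl
  ↑≡× g (suc t) = ≡.cong (g ∙_) (↑≡× g t)

  ↑-cong : ∀ t {x y} → x ≈ y → x ↑ t ≈ y ↑ t
  ↑-cong t {x} {y} x≈y rewrite ↑≡× x t | ↑≡× y t = ×-congʳ t x≈y

  ↑-congʳ : ∀ g {s t} → s ≡ t → g ↑ s ≈ g ↑ t
  ↑-congʳ g ≡.refl = refl

  ↑-homo-+ : ∀ g s t → g ↑ (s + t) ≈ g ↑ s ∙ g ↑ t
  ↑-homo-+ g s t rewrite ↑≡× g (s + t) | ↑≡× g s | ↑≡× g t = ×-homo-+ g s t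

  ↑-* : ∀ g s t → g ↑ (s * t) ≈ (g ↑ s) ↑ t
  ↑-* g s t rewrite ↑≡× (g ↑ s) t | ↑≡× g s | ↑≡× g (s * t) =
    trans (reflexive (≡.cong (_×ᵐ g) (ℕ.*-comm s t))) (sym (×-assocˡ g t s))

  ↑-distrib-∙ : ∀ x y t → (x ∙ y) ↑ t ≈ x ↑ t ∙ y ↑ t
  ↑-distrib-∙ x y t rewrite ↑≡× (x ∙ y) t | ↑≡× x t | ↑≡× y t = ×-distrib-+ x y t

  ε↑ : ∀ t → ε ↑ t ≈ ε
  ε↑ zero    = refl
  ε↑ (suc t) = trans (identityˡ _) (ε↑ t)

  ⁻¹↑ : ∀ x t → (x ⁻¹) ↑ t ≈ (x ↑ t) ⁻¹
  ⁻¹↑ x t = inverseʳ-unique (x ↑ t) ((x ⁻¹) ↑ t) (begin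
    x ↑ t ∙ (x ⁻¹) ↑ t ≈⟨ ↑-distrib-∙ x (x ⁻¹) t ⟨
    (x ∙ x ⁻¹) ↑ t   ≈⟨ ↑-cong t (inverseʳ x) ⟩
    ε ↑ t            ≈⟨ ε↑ t ⟩
    ε                ∎)

  ↑-↑-comm : ∀ g s t → (g ↑ s) ↑ t ≈ (g ↑ t) ↑ s
  ↑-↑-comm g s t = trans (sym (↑-* g s t)) (trans (↑-congʳ g (ℕ.*-comm s t)) (↑-* g t s))

  ↑≈ε⇒↑*≈ε : ∀ g s t → g ↑ s ≈ ε → g ↑ (s * t) ≈ ε
  ↑≈ε⇒↑*≈ε g s t g↑s≈ε = trans (↑-* g s t) (trans (↑-cong t g↑s≈ε) (ε↑ t))

  ⁻¹≈↑ : ∀ {x} N → x ↑ suc N ≈ ε → x ⁻¹ ≈ x ↑ N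
  ⁻¹≈↑ {x} _ x↑suc≈ε = sym (inverseʳ-unique x _ x↑suc≈ε)

  infix 4 _∈⟨_⟩
  _∈⟨_⟩ : Carrier → Carrier → Set ℓ
  x ∈⟨ g ⟩ = ∃ λ t → x ≈ g ↑ t

  ∈⟨⟩-resp : ∀ {g x y} → x ≈ y → x ∈⟨ g ⟩ → y ∈⟨ g ⟩
  ∈⟨⟩-resp x≈y (t , x≈) = t , trans (sym x≈y) x≈

  g∈⟨g⟩ : ∀ g → g ∈⟨ g ⟩
  g∈⟨g⟩ g = 1 , sym (identityʳ g)

  ↑∈⟨⟩ : ∀ g t → g ↑ t ∈⟨ g ⟩
  ↑∈⟨⟩ g t = t , refl

  ∈⟨⟩-∙ : ∀ {g x y} → x ∈⟨ g ⟩ → y ∈⟨ g ⟩ → x ∙ y ∈⟨ g ⟩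
  ∈⟨⟩-∙ {g} (s , x≈) (t , y≈) = s + t , trans (∙-cong x≈ y≈) (sym (↑-homo-+ g s t))

  ∈⟨⟩-respʳ : ∀ {g h x} → g ≈ h → x ∈⟨ g ⟩ → x ∈⟨ h ⟩
  ∈⟨⟩-respʳ g≈h (t , x≈) = t , trans x≈ (↑-cong t g≈h)

  ∈⟨⟩-trans : ∀ {x y z} → x ∈⟨ y ⟩ → y ∈⟨ z ⟩ → x ∈⟨ z ⟩
  ∈⟨⟩-trans {z = z} (s , x≈) (t , y≈) = t * s , trans x≈ (trans (↑-cong s y≈) (sym (↑-* z t s)))

  ∈⟨⟩-⁻¹ : ∀ {g x} → (∃ λ N → g ↑ suc N ≈ ε) → x ∈⟨ g ⟩ → x ⁻¹ ∈⟨ g ⟩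
  ∈⟨⟩-⁻¹ {g} {x} (N , g↑suc≈ε) x∈⟨g⟩@(t , x≈) =
    ∈⟨⟩-trans (∈⟨⟩-resp (sym (⁻¹≈↑ N x↑suc≈ε)) (↑∈⟨⟩ x N)) x∈⟨g⟩
    where
    x↑suc≈ε : x ↑ suc N ≈ ε
    x↑suc≈ε = begin
      x ↑ suc N       ≈⟨ ↑-cong (suc N) x≈ ⟩
      (g ↑ t) ↑ suc N ≈⟨ ↑-* g t (suc N) ⟨
      g ↑ (t * suc N) ≈⟨ ↑-congʳ g (ℕ.*-comm t (suc N)) ⟩
      g ↑ (suc N * t) ≈⟨ ↑≈ε⇒↑*≈ε g (suc N) t g↑suc≈ε ⟩
      ε               ∎

  coprime⇒∈⟨↑⟩ : ∀ {g q N} → g ↑ N ≈ ε → Coprime q N → g ∈⟨ g ↑ q ⟩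
  coprime⇒∈⟨↑⟩ {g} {N = zero} _ q⊥0 with 0-coprimeTo-m⇒m≡1 (⊥-sym q⊥0)
  ... | ≡.refl = 1 , sym (trans (identityʳ _) (identityʳ g))
  coprime⇒∈⟨↑⟩ {g} {q} {N@(suc N′)} g↑N≈ε q⊥N with coprime-Bézout q⊥N
  ... | Bézout.+- s r 1+rN≡sq = s , (begin
    g               ≈⟨ identityʳ g ⟨
    g ∙ ε           ≈⟨ ∙-congˡ (↑≈ε⇒↑*≈ε g N r g↑N≈ε) ⟨
    g ∙ g ↑ (N * r) ≈⟨ ↑-congʳ g (≡.trans (≡.cong suc (ℕ.*-comm N r)) 1+rN≡sq) ⟩
    g ↑ (s * q)     ≈⟨ ↑-congʳ g (ℕ.*-comm s q) ⟩
    g ↑ (q * s)     ≈⟨ ↑-* g q s ⟩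
    (g ↑ q) ↑ s     ∎)
  ... | Bézout.-+ s r 1+sq≡rN =
    ∈⟨⟩-resp (⁻¹-involutive g) (∈⟨⟩-⁻¹ (N′ , ↑q↑N≈ε) (∈⟨⟩-resp g⁻¹≈ (↑∈⟨⟩ (g ↑ q) s)))
    where
    g⁻¹≈ : (g ↑ q) ↑ s ≈ g ⁻¹
    g⁻¹≈ = inverseʳ-unique g _ (begin
      g ∙ (g ↑ q) ↑ s ≈⟨ ∙-congˡ (↑-* g q s) ⟨
      g ↑ suc (q * s) ≈⟨ ↑-congʳ g (≡.trans (≡.cong suc (ℕ.*-comm q s)) 1+sq≡rN) ⟩
      g ↑ (r * N)     ≈⟨ ↑-congʳ g (ℕ.*-comm r N) ⟩
      g ↑ (N * r)     ≈⟨ ↑≈ε⇒↑*≈ε g N r g↑N≈ε ⟩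
      ε               ∎)
    ↑q↑N≈ε : (g ↑ q) ↑ suc N′ ≈ ε
    ↑q↑N≈ε = begin
      (g ↑ q) ↑ N ≈⟨ ↑-* g q N ⟨
      g ↑ (q * N) ≈⟨ ↑-congʳ g (ℕ.*-comm q N) ⟩
      g ↑ (N * q) ≈⟨ ↑≈ε⇒↑*≈ε g N q g↑N≈ε ⟩
      ε           ∎

  coprime-orders⇒∈⟨∙⟩ : ∀ {x y M N} → x ↑ N ≈ ε → y ↑ M ≈ ε → Coprime M N → x ∈⟨ x ∙ y ⟩
  coprime-orders⇒∈⟨∙⟩ {x} {y} {M} x↑N≈ε y↑M≈ε M⊥N =
    ∈⟨⟩-trans (coprime⇒∈⟨↑⟩ x↑N≈ε M⊥N) (∈⟨⟩-resp xy↑M≈x↑M (↑∈⟨⟩ (x ∙ y) M))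
    where
    xy↑M≈x↑M : (x ∙ y) ↑ M ≈ x ↑ M
    xy↑M≈x↑M = trans (↑-distrib-∙ x y M) (trans (∙-congˡ y↑M≈ε) (identityʳ _))

  prime-order⇒∈⟨⟩-sym : ∀ {p x w} → Prime p → x ↑ p ≈ ε → w ∈⟨ x ⟩ → ¬ w ≈ ε → x ∈⟨ w ⟩
  prime-order⇒∈⟨⟩-sym {p} {x} p-prime x↑p≈ε (t , w≈x↑t) w≉ε with p ∣? t
  ... | yes (divides s ≡.refl) =
    contradiction (trans w≈x↑t (trans (↑-congʳ x (ℕ.*-comm s p)) (↑≈ε⇒↑*≈ε x p s x↑p≈ε))) w≉ε
  ... | no  p∤t =
    ∈⟨⟩-trans (coprime⇒∈⟨↑⟩ x↑p≈ε (¬∣⇒coprime p-prime p∤t)) (∈⟨⟩-resp w≈x↑t (g∈⟨g⟩ _))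

  Cocyclic : Carrier → Carrier → Set (c ⊔ ℓ)
  Cocyclic x y = ∃ λ z → x ∈⟨ z ⟩ × y ∈⟨ z ⟩

  adjacent⇒cocyclic : ∀ {x y} → EAdjacent G x y → Cocyclic x y
  adjacent⇒cocyclic (_ , z , m , k , x≈ , y≈) = z , (suc m , x≈) , (suc k , y≈)

  cocyclic-∈⟨⟩ : ∀ {x x′ y} → x′ ∈⟨ x ⟩ → Cocyclic x y → Cocyclic x′ y
  cocyclic-∈⟨⟩ x′∈⟨x⟩ (z , x∈⟨z⟩ , y∈⟨z⟩) = z , ∈⟨⟩-trans x′∈⟨x⟩ x∈⟨z⟩ , y∈⟨z⟩

  -- ⟨x⟩ = Ω₁ = {w | w ↑ p ≈ ε} and x ≉ ε; for prime p: ⟨x⟩ is the unique subgroup of order p.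
  record GeneratesΩ₁ (p : ℕ) (x : Carrier) : Set (c ⊔ ℓ) where
    field
      x≉ε    : ¬ x ≈ ε
      x↑p≈ε  : x ↑ p ≈ ε
      Ω₁⊆⟨x⟩ : ∀ {w} → w ↑ p ≈ ε → w ∈⟨ x ⟩

  Ω₁⊆⟨g⟩⇒root∈⟨g⟩ : ∀ {p x g h y} → GeneratesΩ₁ p x → x ∈⟨ g ⟩ → h ∈⟨ g ⟩ →
                    y ↑ p ≈ h ↑ p → y ∈⟨ g ⟩
  Ω₁⊆⟨g⟩⇒root∈⟨g⟩ {p} {x} {g} {h} {y} Ω x∈⟨g⟩ h∈⟨g⟩ y↑p≈h↑p =
    ∈⟨⟩-resp y∙h⁻¹∙h≈y (∈⟨⟩-∙ (∈⟨⟩-trans (Ω₁⊆⟨x⟩ y∙h⁻¹↑p≈ε) x∈⟨g⟩) h∈⟨g⟩)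
    where
    open GeneratesΩ₁ Ω
    y∙h⁻¹↑p≈ε : (y ∙ h ⁻¹) ↑ p ≈ ε
    y∙h⁻¹↑p≈ε = begin
      (y ∙ h ⁻¹) ↑ p          ≈⟨ ↑-distrib-∙ y (h ⁻¹) p ⟩
      y ↑ p ∙ (h ⁻¹) ↑ p      ≈⟨ ∙-cong y↑p≈h↑p (⁻¹↑ h p) ⟩
      h ↑ p ∙ (h ↑ p) ⁻¹      ≈⟨ inverseʳ (h ↑ p) ⟩
      ε                       ∎
    y∙h⁻¹∙h≈y : y ∙ h ⁻¹ ∙ h ≈ y
    y∙h⁻¹∙h≈y = trans (assoc y (h ⁻¹) h) (trans (∙-congˡ (inverseˡ h)) (identityʳ y))

module Finite {c ℓ : Level} (G : AbelianGroup c ℓ) {n : ℕ} (order : HasOrder G n) where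
  open AbelianGroup G
  open Powers G
  open import Algebra.Properties.CommutativeSemigroup commutativeSemigroup using (interchange)
  open import Algebra.Properties.AbelianGroup G using (identityʳ-unique; ε⁻¹≈ε; ∙-cancelˡ; ⁻¹-∙-comm)
  open import Relation.Binary.Reasoning.Setoid setoid

  private
    enum : Fin n → Carrier
    enum = proj₁ order

    enum-injective : ∀ i j → enum i ≈ enum j → i ≡ j
    enum-injective = proj₁ (proj₂ order)

    position : Carrier → Fin n
    position x = proj₁ (proj₂ (proj₂ order) x)

    enum-position : ∀ x → enum (position x) ≈ x
    enum-position x = proj₂ (proj₂ (proj₂ order) x)

  infix 4 _≈?_
  _≈?_ : Decidable _≈_
  x ≈? y with position x Fin.≟ position y
  ... | yes i≡j = yes (trans (sym (enum-position x)) (trans (reflexive (≡.cong enum i≡j)) (enum-position y)))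
  ... | no  i≢j = no λ x≈y →
    i≢j (enum-injective _ _ (trans (enum-position x) (trans x≈y (sym (enum-position y)))))

  -- Two of g ↑ 0, …, g ↑ n coincide.  Kept abstract, like minimal-power below: unfolding
  -- the pigeonhole search during unification makes type checking blow up.
  abstract
    ∃-exponent : ∀ g → ∃ λ N → g ↑ suc N ≈ ε
    ∃-exponent g with Fin.pigeonhole (ℕ.n<1+n n) (λ i → position (g ↑ toℕ i))
    ... | i , j , i<j , same-index with ℕ.m≤n⇒∃[o]m+o≡n i<j
    ... | N , i+1+N≡j = N , identityʳ-unique (g ↑ toℕ i) (g ↑ suc N) (sym (begin
      g ↑ toℕ i                   ≈⟨ enum-position _ ⟨
      enum (position (g ↑ toℕ i)) ≈⟨ reflexive (≡.cong enum same-index) ⟩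
      enum (position (g ↑ toℕ j)) ≈⟨ enum-position _ ⟩
      g ↑ toℕ j                   ≈⟨ ↑-congʳ g (≡.trans (ℕ.+-suc (toℕ i) N) i+1+N≡j) ⟨
      g ↑ (toℕ i + suc N)         ≈⟨ ↑-homo-+ g (toℕ i) (suc N) ⟩
      g ↑ toℕ i ∙ g ↑ suc N       ∎))

  ∈⟨⟩⇒∈⟨⟩⁺ : ∀ {x z} → x ∈⟨ z ⟩ → ∃ λ m → x ≈ z ↑ suc m
  ∈⟨⟩⇒∈⟨⟩⁺ (suc m , x≈) = m , x≈
  ∈⟨⟩⇒∈⟨⟩⁺ {z = z} (zero , x≈ε) with ∃-exponent z
  ... | N , z↑suc≈ε = N , trans x≈ε (sym z↑suc≈ε)

  cocyclic⇒adjacent : ∀ {x y} → ¬ x ≈ y → Cocyclic x y → EAdjacent G x y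
  cocyclic⇒adjacent x≉y (z , x∈ , y∈) with ∈⟨⟩⇒∈⟨⟩⁺ x∈ | ∈⟨⟩⇒∈⟨⟩⁺ y∈
  ... | m , x≈ | k , y≈ = x≉y , z , m , k , x≈ , y≈

  -- Finite subgroups

  record FinSubgroup : Set (c ⊔ ℓ) where
    field
      size           : ℕ
      elem           : Fin size → Carrier
      elem-injective : ∀ i j → elem i ≈ elem j → i ≡ j
      ε-elem         : ∃ λ i → elem i ≈ ε
      ∙-elem         : ∀ i j → ∃ λ k → elem k ≈ elem i ∙ elem j
      ⁻¹-elem        : ∀ i → ∃ λ k → elem k ≈ elem i ⁻¹

  open FinSubgroup

  infix 4 _∈ₛ_
  _∈ₛ_ : Carrier → FinSubgroup → Set ℓ
  x ∈ₛ H = ∃ λ i → elem H i ≈ x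

  module _ (H : FinSubgroup) where

    ∈ₛ-resp : ∀ {x y} → x ≈ y → x ∈ₛ H → y ∈ₛ H
    ∈ₛ-resp x≈y (i , eᵢ≈x) = i , trans eᵢ≈x x≈y

    ∈ₛ-∙ : ∀ {x y} → x ∈ₛ H → y ∈ₛ H → x ∙ y ∈ₛ H
    ∈ₛ-∙ (i , eᵢ≈x) (j , eⱼ≈y) with ∙-elem H i j
    ... | k , eₖ≈ = k , trans eₖ≈ (∙-cong eᵢ≈x eⱼ≈y)

    ∈ₛ-⁻¹ : ∀ {x} → x ∈ₛ H → x ⁻¹ ∈ₛ H
    ∈ₛ-⁻¹ (i , eᵢ≈x) with ⁻¹-elem H i
    ... | k , eₖ≈ = k , trans eₖ≈ (⁻¹-cong eᵢ≈x)

    ∈ₛ-cancelʳ : ∀ {x y} → x ∙ y ∈ₛ H → y ∈ₛ H → x ∈ₛ H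
    ∈ₛ-cancelʳ {x} {y} xy∈ y∈ = ∈ₛ-resp x∙y∙y⁻¹≈x (∈ₛ-∙ xy∈ (∈ₛ-⁻¹ y∈))
      where
      x∙y∙y⁻¹≈x : x ∙ y ∙ y ⁻¹ ≈ x
      x∙y∙y⁻¹≈x = trans (assoc x y (y ⁻¹)) (trans (∙-congˡ (inverseʳ y)) (identityʳ x))

    ↑∈ₛ : ∀ {x} t → x ∈ₛ H → x ↑ t ∈ₛ H
    ↑∈ₛ zero    _  = ε-elem H
    ↑∈ₛ (suc t) x∈ = ∈ₛ-∙ x∈ (↑∈ₛ t x∈)

    ∈ₛ? : ∀ x → Dec (x ∈ₛ H)
    ∈ₛ? x = Fin.any? (λ i → elem H i ≈? x)

  private
    enumeration-≤ : ∀ {k m} (e : Fin k → Carrier) (f : Fin m → Carrier) →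
                    (∀ i j → e i ≈ e j → i ≡ j) → (∀ i → ∃ λ j → f j ≈ e i) → k ≤ m
    enumeration-≤ e f e-injective covered = Fin.injective⇒≤ {f = λ i → proj₁ (covered i)}
      λ {i} {j} same → e-injective i j
        (trans (sym (proj₂ (covered i))) (trans (reflexive (≡.cong f same)) (proj₂ (covered j))))

  ⊆⇒size≤ : ∀ H K → (∀ i → elem H i ∈ₛ K) → size H ≤ size K
  ⊆⇒size≤ H K = enumeration-≤ (elem H) (elem K) (elem-injective H)

  size≤n : ∀ H → size H ≤ n
  size≤n H = enumeration-≤ (elem H) enum (elem-injective H) (λ i → position _ , enum-position _)

  private
    ⊇G⇒n≤size : ∀ H → (∀ i → enum i ∈ₛ H) → n ≤ size H
    ⊇G⇒n≤size H = enumeration-≤ enum (elem H) enum-injective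

  trivial : FinSubgroup
  trivial = record
    { size           = 1
    ; elem           = λ _ → ε
    ; elem-injective = λ { Fin.zero Fin.zero _ → ≡.refl }
    ; ε-elem         = Fin.zero , refl
    ; ∙-elem         = λ _ _ → Fin.zero , sym (identityˡ ε)
    ; ⁻¹-elem        = λ _ → Fin.zero , sym ε⁻¹≈ε
    }

  ∈trivial⇒≈ε : ∀ {x} → x ∈ₛ trivial → x ≈ ε
  ∈trivial⇒≈ε (_ , ε≈x) = sym ε≈x

  private
    abstract
      minimal-power : ∀ H y → ∃ λ m → y ↑ suc m ∈ₛ H × (∀ {k} → k < m → ¬ y ↑ suc k ∈ₛ H)
      minimal-power H y with ∃-exponent y
      ... | N , y↑suc≈ε =
        least-witness (λ t → ∈ₛ? H (y ↑ suc t)) N (∈ₛ-resp H (sym y↑suc≈ε) (ε-elem H))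

  -- The order of y in G/H.
  relOrd : FinSubgroup → Carrier → ℕ
  relOrd H y = suc (proj₁ (minimal-power H y))

  module _ (H : FinSubgroup) (y : Carrier) where

    ↑relOrd∈ₛ : y ↑ relOrd H y ∈ₛ H
    ↑relOrd∈ₛ = proj₁ (proj₂ (minimal-power H y))

    relOrd-minimal : ∀ {t} → t < relOrd H y → y ↑ t ∈ₛ H → t ≡ 0
    relOrd-minimal {zero}  _         _  = ≡.refl
    relOrd-minimal {suc t} (s≤s t<m) y↑∈ = contradiction y↑∈ (proj₂ (proj₂ (minimal-power H y)) t<m)

    ↑∈ₛ⇒relOrd∣ : ∀ t → y ↑ t ∈ₛ H → relOrd H y ∣ t
    ↑∈ₛ⇒relOrd∣ t y↑t∈ = m%n≡0⇒n∣m t J (relOrd-minimal (m%n<n t J) y↑r∈)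
      where
      J : ℕ
      J = relOrd H y
      t≡ : t ≡ t % J + J * (t / J)
      t≡ = ≡.trans (m≡m%n+[m/n]*n t J) (≡.cong (t % J +_) (ℕ.*-comm (t / J) J))
      y↑t≈ : y ↑ t ≈ y ↑ (t % J) ∙ (y ↑ J) ↑ (t / J)
      y↑t≈ = begin
        y ↑ t                           ≈⟨ ↑-congʳ y t≡ ⟩
        y ↑ (t % J + J * (t / J))       ≈⟨ ↑-homo-+ y (t % J) (J * (t / J)) ⟩
        y ↑ (t % J) ∙ y ↑ (J * (t / J)) ≈⟨ ∙-congˡ (↑-* y J (t / J)) ⟩
        y ↑ (t % J) ∙ (y ↑ J) ↑ (t / J) ∎
      y↑r∈ : y ↑ (t % J) ∈ₛ H
      y↑r∈ = ∈ₛ-cancelʳ H (∈ₛ-resp H y↑t≈ y↑t∈) (↑∈ₛ H (t / J) ↑relOrd∈ₛ)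

  module _ (H : FinSubgroup) (y : Carrier) where
    private
      J : ℕ
      J = relOrd H y

      pair : Fin J × Fin (size H) → Carrier
      pair (a , b) = y ↑ toℕ a ∙ elem H b

      pair-gap : ∀ {a a′ b b′ d} → toℕ a + d ≡ toℕ a′ →
                 pair (a , b) ≈ pair (a′ , b′) → elem H b ≈ y ↑ d ∙ elem H b′
      pair-gap {a} {a′} {b} {b′} {d} a+d≡a′ same = ∙-cancelˡ (y ↑ toℕ a) _ _ (begin
        y ↑ toℕ a ∙ elem H b             ≈⟨ same ⟩
        y ↑ toℕ a′ ∙ elem H b′           ≈⟨ ∙-congʳ (↑-congʳ y (≡.sym a+d≡a′)) ⟩
        y ↑ (toℕ a + d) ∙ elem H b′      ≈⟨ ∙-congʳ (↑-homo-+ y (toℕ a) d) ⟩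
        y ↑ toℕ a ∙ y ↑ d ∙ elem H b′    ≈⟨ assoc _ _ _ ⟩
        y ↑ toℕ a ∙ (y ↑ d ∙ elem H b′)  ∎)

      -- If the exponents differed by d > 0, then y ↑ d ∈ H with d < J.
      pair-injective-≤ : ∀ {a a′ b b′} → toℕ a ≤ toℕ a′ →
                         pair (a , b) ≈ pair (a′ , b′) → toℕ a ≡ toℕ a′ × b ≡ b′
      pair-injective-≤ {a} {a′} {b} {b′} a≤a′ same with ℕ.m≤n⇒∃[o]m+o≡n a≤a′
      ... | d , a+d≡a′ with relOrd-minimal H y d<J (∈ₛ-cancelʳ H (b , gap) (b′ , refl))
        where
        gap : elem H b ≈ y ↑ d ∙ elem H b′
        gap = pair-gap {a} {a′} {b} {b′} a+d≡a′ same
        d<J : d < J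
        d<J = ℕ.≤-<-trans (ℕ.m≤n+m d (toℕ a)) (≡.subst (_< J) (≡.sym a+d≡a′) (Fin.toℕ<n a′))
      ... | ≡.refl = ≡.trans (≡.sym (ℕ.+-identityʳ _)) a+d≡a′ ,
        elem-injective H b b′ (trans (pair-gap {a} {a′} {b} {b′} a+d≡a′ same) (identityˡ _))

      pair-injective : ∀ ab ab′ → pair ab ≈ pair ab′ → ab ≡ ab′
      pair-injective (a , b) (a′ , b′) same with ℕ.≤-total (toℕ a) (toℕ a′)
      ... | inj₁ a≤a′ with pair-injective-≤ a≤a′ same
      ...   | a≡a′ , ≡.refl = ≡.cong (_, b) (Fin.toℕ-injective a≡a′)
      pair-injective (a , b) (a′ , b′) same | inj₂ a′≤a with pair-injective-≤ a′≤a (sym same)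
      ...   | a′≡a , ≡.refl = ≡.cong (_, b) (Fin.toℕ-injective (≡.sym a′≡a))

      exponent : Fin (J * size H) → ℕ
      exponent i = toℕ (proj₁ (remQuot {J} (size H) i))

      component : Fin (J * size H) → Fin (size H)
      component i = proj₂ (remQuot {J} (size H) i)

      elems : Fin (J * size H) → Carrier
      elems i = pair (remQuot {J} (size H) i)

      elems-spanning : ∀ {x h} → x ∈⟨ y ⟩ → h ∈ₛ H → ∃ λ i → elems i ≈ x ∙ h
      elems-spanning {x} {h} (t , x≈y↑t) h∈ = combine a b , (begin
        elems (combine a b)              ≈⟨ reflexive (≡.cong pair (Fin.remQuot-combine a b)) ⟩
        y ↑ toℕ a ∙ elem H b             ≈⟨ ∙-cong (↑-congʳ y (Fin.toℕ-fromℕ< (m%n<n t J))) eb≈ ⟩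
        y ↑ (t % J) ∙ (y ↑ (J * (t / J)) ∙ h) ≈⟨ assoc _ _ _ ⟨
        y ↑ (t % J) ∙ y ↑ (J * (t / J)) ∙ h   ≈⟨ ∙-congʳ (↑-homo-+ y (t % J) (J * (t / J))) ⟨
        y ↑ (t % J + J * (t / J)) ∙ h    ≈⟨ ∙-congʳ (↑-congʳ y t≡) ⟨
        y ↑ t ∙ h                        ≈⟨ ∙-congʳ x≈y↑t ⟨
        x ∙ h                            ∎)
        where
        t≡ : t ≡ t % J + J * (t / J)
        t≡ = ≡.trans (m≡m%n+[m/n]*n t J) (≡.cong (t % J +_) (ℕ.*-comm (t / J) J))
        a : Fin J
        a = fromℕ< (m%n<n t J)
        y↑Jq∈ : y ↑ (J * (t / J)) ∈ₛ H
        y↑Jq∈ = ∈ₛ-resp H (sym (↑-* y J (t / J))) (↑∈ₛ H (t / J) (↑relOrd∈ₛ H y))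
        b : Fin (size H)
        b = proj₁ (∈ₛ-∙ H y↑Jq∈ h∈)
        eb≈ : elem H b ≈ y ↑ (J * (t / J)) ∙ h
        eb≈ = proj₂ (∈ₛ-∙ H y↑Jq∈ h∈)

    adjoin : FinSubgroup
    adjoin = record
      { size           = J * size H
      ; elem           = elems
      ; elem-injective = λ i j same →
          Injection.injective (↔⇒↣ Fin.*↔×) (pair-injective _ _ same)
      ; ε-elem         = ∈ₛ-resp′ (identityˡ ε) (elems-spanning (↑∈⟨⟩ y 0) (ε-elem H))
      ; ∙-elem         = λ i j → ∈ₛ-resp′ (interchange _ _ _ _)
          (elems-spanning (∈⟨⟩-∙ (↑∈⟨⟩ y (exponent i)) (↑∈⟨⟩ y (exponent j)))
                          (∈ₛ-∙ H (component i , refl) (component j , refl)))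
      ; ⁻¹-elem        = λ i → ∈ₛ-resp′ (⁻¹-∙-comm _ _)
          (elems-spanning (∈⟨⟩-⁻¹ (∃-exponent y) (↑∈⟨⟩ y (exponent i)))
                          (∈ₛ-⁻¹ H (component i , refl)))
      }
      where
      ∈ₛ-resp′ : ∀ {x z} → x ≈ z → (∃ λ i → elems i ≈ x) → ∃ λ i → elems i ≈ z
      ∈ₛ-resp′ x≈z (i , eᵢ≈x) = i , trans eᵢ≈x x≈z

    ∈adjoin : ∀ {x h} → x ∈⟨ y ⟩ → h ∈ₛ H → x ∙ h ∈ₛ adjoin
    ∈adjoin = elems-spanning

    ∈adjoin⇒ : ∀ {x} → x ∈ₛ adjoin → ∃ λ t → ∃ λ h → h ∈ₛ H × x ≈ y ↑ t ∙ h
    ∈adjoin⇒ (i , eᵢ≈x) = exponent i , elem H (component i) , (component i , refl) , sym eᵢ≈x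

    ⊆adjoin : ∀ {h} → h ∈ₛ H → h ∈ₛ adjoin
    ⊆adjoin h∈ = ∈ₛ-resp adjoin (identityˡ _) (∈adjoin (↑∈⟨⟩ y 0) h∈)

    y∈adjoin : y ∈ₛ adjoin
    y∈adjoin = ∈ₛ-resp adjoin (identityʳ y) (∈adjoin (g∈⟨g⟩ y) (ε-elem H))

  ∉⇒relOrd>1 : ∀ H {y} → ¬ y ∈ₛ H → 1 < relOrd H y
  ∉⇒relOrd>1 H {y} y∉ with proj₁ (minimal-power H y) | ↑relOrd∈ₛ H y
  ... | zero  | y↑1∈ = contradiction (∈ₛ-resp H (identityʳ y) y↑1∈) y∉
  ... | suc _ | _    = s≤s (s≤s z≤n)

  size-nonZero : ∀ H → ℕ.NonZero (size H)
  size-nonZero H with size H | proj₁ (ε-elem H)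
  ... | suc _ | _ = _

  size-adjoin> : ∀ H {y} → ¬ y ∈ₛ H → size H < size (adjoin H y)
  size-adjoin> H {y} y∉ = ≡.subst (size H <_) (ℕ.*-comm (size H) (relOrd H y))
    (ℕ.m<m*n (size H) (relOrd H y) {{size-nonZero H}} (∉⇒relOrd>1 H y∉))

  -- Lagrange's theorem and Cauchy's theorem for G/H

  -- The index [G : H], with the information on its prime divisors that Cauchy's theorem needs.
  record Index (H : FinSubgroup) : Set c where
    field
      index        : ℕ
      n≡size*index : n ≡ size H * index
      prime∣index⇒ : ∀ {q} → Prime q → q ∣ index → ∃ λ y → q ∣ relOrd H y

  private
    index-whole : ∀ H → (∀ i → enum i ∈ₛ H) → Index H
    index-whole H all∈ = record
      { index        = 1
      ; n≡size*index = ≡.trans (ℕ.≤-antisym (⊇G⇒n≤size H all∈) (size≤n H)) (≡.sym (ℕ.*-identityʳ _))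
      ; prime∣index⇒ = λ q-prime q∣1 → contradiction (≡.subst Prime (∣1⇒≡1 q∣1) q-prime) ¬prime[1]
      }

    index-adjoin : ∀ H y → Index (adjoin H y) → Index H
    index-adjoin H y record { index = i′ ; n≡size*index = n≡ ; prime∣index⇒ = witness } = record
      { index        = relOrd H y * i′
      ; n≡size*index = ≡.trans n≡ (≡.trans (≡.cong (_* i′) (ℕ.*-comm (relOrd H y) (size H)))
                                           (ℕ.*-assoc (size H) (relOrd H y) i′))
      ; prime∣index⇒ = prime∣index⇒
      }
      where
      prime∣index⇒ : ∀ {q} → Prime q → q ∣ relOrd H y * i′ → ∃ λ y′ → q ∣ relOrd H y′
      prime∣index⇒ q-prime q∣ with euclidsLemma (relOrd H y) i′ q-prime q∣
      ... | inj₁ q∣J = y , q∣J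
      ... | inj₂ q∣i′ with witness q-prime q∣i′
      ...   | y′ , q∣J′ = y′ , ∣-trans q∣J′
                (↑∈ₛ⇒relOrd∣ (adjoin H y) y′ (relOrd H y′) (⊆adjoin H y (↑relOrd∈ₛ H y′)))

    -- Adjoin elements outside H until H is all of G; the fuel F bounds n - |H|.
    index-from : ∀ F H → n ≤ F + size H → Index H
    index-from F H n≤F+size with Fin.all? (λ i → ∈ₛ? H (enum i))
    ... | yes all∈ = index-whole H all∈
    ... | no ¬all∈ with Fin.¬∀⟶∃¬ n _ (λ i → ∈ₛ? H (enum i)) ¬all∈
    index-from zero H n≤size | no _ | i , y∉ =
      contradiction (size≤n (adjoin H (enum i))) (ℕ.<⇒≱ (ℕ.≤-<-trans n≤size (size-adjoin> H y∉)))
    index-from (suc F) H n≤F+size | no _ | i , y∉ =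
      index-adjoin H (enum i) (index-from F (adjoin H (enum i))
        (ℕ.≤-trans n≤F+size (ℕ.≤-trans (ℕ.≤-reflexive (≡.sym (ℕ.+-suc F (size H))))
                                        (ℕ.+-monoʳ-≤ F (size-adjoin> H y∉)))))

  lagrange : ∀ H → Index H
  lagrange H = index-from n H (ℕ.m≤m+n n (size H))

  size∣n : ∀ H → size H ∣ n
  size∣n H = divides index (≡.trans n≡size*index (ℕ.*-comm (size H) index))
    where open Index (lagrange H)

  cauchy-quotient : ∀ {q} H → Prime q → size H * q ∣ n → ∃ λ y → ¬ y ∈ₛ H × y ↑ q ∈ₛ H
  cauchy-quotient {q} H q-prime kq∣n with prime∣index⇒ q-prime q∣index
    where
    open Index (lagrange H)
    q∣index : q ∣ index
    q∣index = *-cancelˡ-∣ (size H) {{size-nonZero H}} (≡.subst (size H * q ∣_) n≡size*index kq∣n)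
  ... | y , divides zero    J≡ = contradiction J≡ λ ()
  ... | y , divides (suc m) J≡ = y ↑ suc m , y↑∉ , y↑q∈
    where
    y↑q∈ : (y ↑ suc m) ↑ q ∈ₛ H
    y↑q∈ = ∈ₛ-resp H (trans (↑-congʳ y J≡) (↑-* y (suc m) q)) (↑relOrd∈ₛ H y)
    1+m<J : suc m < relOrd H y
    1+m<J = ≡.subst (suc m <_) (≡.sym J≡) (ℕ.m<m*n (suc m) q (prime⇒>1 q-prime))
    y↑∉ : ¬ y ↑ suc m ∈ₛ H
    y↑∉ y↑∈ = ℕ.1+n≢0 (relOrd-minimal H y 1+m<J y↑∈)

  -- Orders of elements and Ω₁

  ord : Carrier → ℕ
  ord = relOrd trivial

  module _ (g : Carrier) where

    ↑ord≈ε : g ↑ ord g ≈ ε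
    ↑ord≈ε = ∈trivial⇒≈ε (↑relOrd∈ₛ trivial g)

    ↑≈ε⇒ord∣ : ∀ t → g ↑ t ≈ ε → ord g ∣ t
    ↑≈ε⇒ord∣ t g↑t≈ε = ↑∈ₛ⇒relOrd∣ trivial g t (Fin.zero , sym g↑t≈ε)

    ord∣⇒↑≈ε : ∀ {t} → ord g ∣ t → g ↑ t ≈ ε
    ord∣⇒↑≈ε (divides q ≡.refl) =
      trans (↑-congʳ g (ℕ.*-comm q (ord g))) (↑≈ε⇒↑*≈ε g (ord g) q ↑ord≈ε)

    ord-minimal : ∀ {t} → t < ord g → g ↑ t ≈ ε → t ≡ 0
    ord-minimal t<ord g↑t≈ε = relOrd-minimal trivial g t<ord (Fin.zero , sym g↑t≈ε)

  ⟨_⟩ : Carrier → FinSubgroup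
  ⟨ g ⟩ = adjoin trivial g

  size⟨⟩ : ∀ g → size ⟨ g ⟩ ≡ ord g
  size⟨⟩ g = ℕ.*-identityʳ (ord g)

  ∈⟨⟩⇒∈ₛ : ∀ {g x} → x ∈⟨ g ⟩ → x ∈ₛ ⟨ g ⟩
  ∈⟨⟩⇒∈ₛ {g} x∈ = ∈ₛ-resp ⟨ g ⟩ (identityʳ _) (∈adjoin trivial g x∈ (ε-elem trivial))

  ∈ₛ⇒∈⟨⟩ : ∀ {g x} → x ∈ₛ ⟨ g ⟩ → x ∈⟨ g ⟩
  ∈ₛ⇒∈⟨⟩ {g} x∈ with ∈adjoin⇒ trivial g x∈
  ... | t , h , h∈ , x≈ = t , trans x≈ (trans (∙-congˡ (∈trivial⇒≈ε h∈)) (identityʳ _))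

  ord∣n : ∀ g → ord g ∣ n
  ord∣n g = ≡.subst (_∣ n) (size⟨⟩ g) (size∣n ⟨ g ⟩)

  ord≡p^suc : ∀ {p g} → Prime p → ∀ b → g ↑ p ^ suc b ≈ ε → ¬ g ↑ p ^ b ≈ ε → ord g ≡ p ^ suc b
  ord≡p^suc {g = g} p-prime b g↑p^suc≈ε g↑p^b≉ε =
    ∣p^suc∧∤p^⇒≡ p-prime b (↑≈ε⇒ord∣ g _ g↑p^suc≈ε) (λ ord∣p^b → g↑p^b≉ε (ord∣⇒↑≈ε g ord∣p^b))

  ∣ord⇒order-p-element : ∀ {p y} → Prime p → p ∣ ord y →
                         ∃ λ w → w ∈⟨ y ⟩ × ¬ w ≈ ε × w ↑ p ≈ ε
  ∣ord⇒order-p-element {p} {y} p-prime (divides zero ())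
  ∣ord⇒order-p-element {p} {y} p-prime (divides s@(suc _) ord≡sp) =
    y ↑ s , ↑∈⟨⟩ y s , y↑s≉ε , trans (sym (↑-* y s p)) (trans (↑-congʳ y (≡.sym ord≡sp)) (↑ord≈ε y))
    where
    s<ord : s < ord y
    s<ord = ≡.subst (s <_) (≡.sym ord≡sp) (ℕ.m<m*n s p (prime⇒>1 p-prime))
    y↑s≉ε : ¬ y ↑ s ≈ ε
    y↑s≉ε y↑s≈ε = ℕ.1+n≢0 (ord-minimal y s<ord y↑s≈ε)

  Ω₁⟨z⟩⊆⟨z↑o′⟩ : ∀ {z p w} o′ → .{{ℕ.NonZero p}} → ord z ≡ o′ * p →
                 w ∈⟨ z ⟩ → w ↑ p ≈ ε → w ∈⟨ z ↑ o′ ⟩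
  Ω₁⟨z⟩⊆⟨z↑o′⟩ {z} {p} o′ ord≡ (t , w≈z↑t) w↑p≈ε with o′∣t
    where
    z↑tp≈ε : z ↑ (t * p) ≈ ε
    z↑tp≈ε = trans (↑-* z t p) (trans (↑-cong p (sym w≈z↑t)) w↑p≈ε)
    o′∣t : o′ ∣ t
    o′∣t = *-cancelʳ-∣ p (≡.subst (_∣ t * p) ord≡ (↑≈ε⇒ord∣ z (t * p) z↑tp≈ε))
  ... | divides k ≡.refl = k , trans w≈z↑t (trans (↑-congʳ z (ℕ.*-comm k o′)) (↑-* z o′ k))

  Ω₁⟨z⟩⊆⟨x⟩ : ∀ {p x z w} → Prime p → x ↑ p ≈ ε → ¬ x ≈ ε →
              x ∈⟨ z ⟩ → w ∈⟨ z ⟩ → w ↑ p ≈ ε → w ∈⟨ x ⟩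
  Ω₁⟨z⟩⊆⟨x⟩ {p} {x} {z} {w} p-prime x↑p≈ε x≉ε x∈⟨z⟩@(s , x≈z↑s) w∈⟨z⟩ w↑p≈ε
    with p ∣? ord z
  ... | no p∤o = contradiction x≈ε x≉ε
    where
    z↑sp≈ε : z ↑ (p * s) ≈ ε
    z↑sp≈ε = trans (↑-congʳ z (ℕ.*-comm p s)) (trans (↑-* z s p) (trans (↑-cong p (sym x≈z↑s)) x↑p≈ε))
    x≈ε : x ≈ ε
    x≈ε = trans x≈z↑s (ord∣⇒↑≈ε z (coprime-divisor (¬∣⇒coprime p-prime p∤o) (↑≈ε⇒ord∣ z _ z↑sp≈ε)))
  ... | yes (divides o′ ord≡) =
    ∈⟨⟩-trans (Ω₁⟨z⟩⊆⟨z↑o′⟩ o′ ord≡ w∈⟨z⟩ w↑p≈ε)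
      (prime-order⇒∈⟨⟩-sym p-prime u↑p≈ε (Ω₁⟨z⟩⊆⟨z↑o′⟩ o′ ord≡ x∈⟨z⟩ x↑p≈ε) x≉ε)
    where
    instance _ = prime⇒nonZero p-prime
    u↑p≈ε : (z ↑ o′) ↑ p ≈ ε
    u↑p≈ε = trans (sym (↑-* z o′ p)) (trans (↑-congʳ z (≡.sym ord≡)) (↑ord≈ε z))

  -- Cone vertices

  cone⇒cocyclic : ∀ {x} → IsConeVertex G x → ∀ y → Cocyclic x y
  cone⇒cocyclic {x} (_ , adjacent) y with y ≈? x
  ... | yes y≈x = x , g∈⟨g⟩ x , ∈⟨⟩-resp (sym y≈x) (g∈⟨g⟩ x)
  ... | no  y≉x = adjacent⇒cocyclic (adjacent y y≉x)

  cocyclic⇒cone : ∀ {x} → ¬ x ≈ ε → (∀ y → Cocyclic x y) → IsConeVertex G x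
  cocyclic⇒cone x≉ε cocyclic =
    x≉ε , λ y y≉x → cocyclic⇒adjacent (λ x≈y → y≉x (sym x≈y)) (cocyclic y)

  cocyclic⇒Ω₁ : ∀ {p x} → Prime p → ¬ x ≈ ε → x ↑ p ≈ ε → (∀ y → Cocyclic x y) → GeneratesΩ₁ p x
  cocyclic⇒Ω₁ p-prime x≉ε x↑p≈ε cocyclic = record
    { x≉ε    = x≉ε
    ; x↑p≈ε  = x↑p≈ε
    ; Ω₁⊆⟨x⟩ = λ {w} w↑p≈ε → let z , x∈⟨z⟩ , w∈⟨z⟩ = cocyclic w in
                 Ω₁⟨z⟩⊆⟨x⟩ p-prime x↑p≈ε x≉ε x∈⟨z⟩ w∈⟨z⟩ w↑p≈ε
    }

  Ω₁⇒cocyclic : ∀ {p x} → Prime p → GeneratesΩ₁ p x → ∀ y → Cocyclic x y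
  Ω₁⇒cocyclic {p} {x} p-prime Ω y with p ∣? ord y
  ... | no p∤ord = x ∙ y ,
    coprime-orders⇒∈⟨∙⟩ x↑p≈ε (↑ord≈ε y) ord⊥p ,
    ∈⟨⟩-respʳ (comm y x) (coprime-orders⇒∈⟨∙⟩ (↑ord≈ε y) x↑p≈ε (⊥-sym ord⊥p))
    where
    open GeneratesΩ₁ Ω
    ord⊥p : Coprime (ord y) p
    ord⊥p = ¬∣⇒coprime p-prime p∤ord
  ... | yes p∣ord with ∣ord⇒order-p-element p-prime p∣ord
  ...   | w , w∈⟨y⟩ , w≉ε , w↑p≈ε =
    y , ∈⟨⟩-trans (prime-order⇒∈⟨⟩-sym p-prime x↑p≈ε (Ω₁⊆⟨x⟩ w↑p≈ε) w≉ε) w∈⟨y⟩ , g∈⟨g⟩ y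
    where open GeneratesΩ₁ Ω

  cone⇒Ω₁ : ∀ {x} → IsConeVertex G x → ∃ λ p → Prime p × ∃ (GeneratesΩ₁ p)
  cone⇒Ω₁ {x} cone@(x≉ε , _) with ∃-prime-divisor (ord x) (∉⇒relOrd>1 trivial (x≉ε ∘ ∈trivial⇒≈ε))
  ... | p , p-prime , p∣ord with ∣ord⇒order-p-element p-prime p∣ord
  ...   | x′ , x′∈⟨x⟩ , x′≉ε , x′↑p≈ε =
    p , p-prime , x′ ,
    cocyclic⇒Ω₁ p-prime x′≉ε x′↑p≈ε (λ y → cocyclic-∈⟨⟩ x′∈⟨x⟩ (cone⇒cocyclic cone y))

  Ω₁⇒cone : ∀ {p x} → Prime p → GeneratesΩ₁ p x → IsConeVertex G x
  Ω₁⇒cone p-prime Ω = cocyclic⇒cone (GeneratesΩ₁.x≉ε Ω) (Ω₁⇒cocyclic p-prime Ω)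

  -- Cyclic Sylow subgroups

  module _ {P : Carrier → Set (c ⊔ ℓ)} {k : ℕ} (P≤G : IsSubgroup G P) (P-size : HasSize G P k) where
    private
      f : Fin k → Σ Carrier P
      f = proj₁ P-size
      f-covers : ∀ x → P x → ∃ λ i → proj₁ (f i) ≈ x
      f-covers = proj₂ (proj₂ P-size)
      open IsSubgroup P≤G

    fromSubgroup : FinSubgroup
    fromSubgroup = record
      { size           = k
      ; elem           = proj₁ ∘ f
      ; elem-injective = proj₁ (proj₂ P-size)
      ; ε-elem         = f-covers ε ε∈
      ; ∙-elem         = λ i j → f-covers _ (∙∈ (proj₂ (f i)) (proj₂ (f j)))
      ; ⁻¹-elem        = λ i → f-covers _ (⁻¹∈ (proj₂ (f i)))
      }

    ∈fromSubgroup⇒ : ∀ {x} → x ∈ₛ fromSubgroup → P x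
    ∈fromSubgroup⇒ (i , fᵢ≈x) = resp fᵢ≈x (proj₂ (f i))

    ⇒∈fromSubgroup : ∀ {x} → P x → x ∈ₛ fromSubgroup
    ⇒∈fromSubgroup = f-covers _

  ⟦_⟧ : FinSubgroup → Carrier → Set (c ⊔ ℓ)
  ⟦ H ⟧ x = Lift c (x ∈ₛ H)

  ⟦⟧-isSubgroup : ∀ H → IsSubgroup G ⟦ H ⟧
  ⟦⟧-isSubgroup H = record
    { resp = λ x≈y (lift x∈) → lift (∈ₛ-resp H x≈y x∈)
    ; ε∈   = lift (ε-elem H)
    ; ∙∈   = λ (lift x∈) (lift y∈) → lift (∈ₛ-∙ H x∈ y∈)
    ; ⁻¹∈  = λ (lift x∈) → lift (∈ₛ-⁻¹ H x∈)
    }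

  ⟦⟧-hasSize : ∀ H → HasSize G ⟦ H ⟧ (size H)
  ⟦⟧-hasSize H = (λ i → elem H i , lift (i , refl)) , elem-injective H , λ _ (lift x∈) → x∈

  p∤index⇒Ω₁⊆ : ∀ {p w} H → Prime p → ¬ p * size H ∣ n → w ↑ p ≈ ε → w ∈ₛ H
  p∤index⇒Ω₁⊆ {p} {w} H p-prime p*size∤n w↑p≈ε
    with prime⇒irreducible p-prime (↑∈ₛ⇒relOrd∣ H w p (∈ₛ-resp H (sym w↑p≈ε) (ε-elem H)))
  ... | inj₁ J≡1 = ∈ₛ-resp H (identityʳ w) (≡.subst (λ t → w ↑ t ∈ₛ H) J≡1 (↑relOrd∈ₛ H w))
  ... | inj₂ J≡p = contradiction (≡.subst (λ J → J * size H ∣ n) J≡p (size∣n (adjoin H w))) p*size∤n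

  cyclicSylow⇒Ω₁ : ∀ {p P} → Prime p → p ∣ n → IsSylow G p n P → IsCyclicSubgroup G P →
                   ∃ (GeneratesΩ₁ p)
  cyclicSylow⇒Ω₁ {p} p-prime p∣n (_ , zero , _ , _ , p^1∤n) _ =
    contradiction (≡.subst (_∣ n) (≡.sym (ℕ.*-identityʳ p)) p∣n) p^1∤n
  cyclicSylow⇒Ω₁ {p} {P} p-prime _ (P≤G , suc a , P-size , _ , p^2+a∤n) (g , g∈P , P⊆⟨g⟩) =
    g ↑ p ^ a , record
      { x≉ε    = λ g↑p^a≈ε → p^suc∤p^ p-prime a (≡.subst (_∣ p ^ a) ord≡ (↑≈ε⇒ord∣ g _ g↑p^a≈ε))
      ; x↑p≈ε  = trans (sym (↑-* g (p ^ a) p)) (ord∣⇒↑≈ε g (∣-reflexive ord≡p^a*p))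
      ; Ω₁⊆⟨x⟩ = λ w↑p≈ε → Ω₁⟨z⟩⊆⟨z↑o′⟩ (p ^ a) ord≡p^a*p
          (P⊆⟨g⟩ _ (∈fromSubgroup⇒ P≤G P-size (p∤index⇒Ω₁⊆ H p-prime p^2+a∤n w↑p≈ε))) w↑p≈ε
      }
    where
    instance _ = prime⇒nonZero p-prime
    H : FinSubgroup
    H = fromSubgroup P≤G P-size
    ⟨g⟩⊆H : ∀ i → elem ⟨ g ⟩ i ∈ₛ H
    ⟨g⟩⊆H i with ∈ₛ⇒∈⟨⟩ (i , refl)
    ... | t , eᵢ≈g↑t = ∈ₛ-resp H (sym eᵢ≈g↑t) (↑∈ₛ H t (⇒∈fromSubgroup P≤G P-size g∈P))
    H⊆⟨g⟩ : ∀ i → elem H i ∈ₛ ⟨ g ⟩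
    H⊆⟨g⟩ i = ∈⟨⟩⇒∈ₛ (P⊆⟨g⟩ _ (∈fromSubgroup⇒ P≤G P-size (i , refl)))
    ord≡ : ord g ≡ p ^ suc a
    ord≡ = ≡.trans (≡.sym (size⟨⟩ g)) (ℕ.≤-antisym (⊆⇒size≤ ⟨ g ⟩ H ⟨g⟩⊆H) (⊆⇒size≤ H ⟨ g ⟩ H⊆⟨g⟩))
    ord≡p^a*p : ord g ≡ p ^ a * p
    ord≡p^a*p = ≡.trans ord≡ (ℕ.*-comm p (p ^ a))

  root-of-generator : ∀ {p g y c} → Prime p → ∀ k → ord g ≡ p ^ suc k → y ↑ p ≈ g ↑ c → ¬ p ∣ c →
                      ord y ≡ p ^ suc (suc k) × g ∈⟨ y ⟩
  root-of-generator {p} {g} {y} {c} p-prime k ord≡ y↑p≈g↑c p∤c =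
    ord≡p^suc p-prime (suc k) y↑p^2+k≈ε y↑p^1+k≉ε , g∈⟨y⟩
    where
    instance _ = ℕ.m^n≢0 p k {{prime⇒nonZero p-prime}}
    y↑p*≈ : ∀ m → y ↑ (p * m) ≈ (g ↑ m) ↑ c
    y↑p*≈ m = trans (↑-* y p m) (trans (↑-cong m y↑p≈g↑c) (↑-↑-comm g c m))
    g↑p^1+k≈ε : g ↑ p ^ suc k ≈ ε
    g↑p^1+k≈ε = ord∣⇒↑≈ε g (∣-reflexive ord≡)
    y↑p^2+k≈ε : y ↑ p ^ suc (suc k) ≈ ε
    y↑p^2+k≈ε = trans (y↑p*≈ (p ^ suc k)) (trans (↑-cong c g↑p^1+k≈ε) (ε↑ c))
    y↑p^1+k≉ε : ¬ y ↑ p ^ suc k ≈ ε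
    y↑p^1+k≉ε y↑p^1+k≈ε = p∤c (*-cancelʳ-∣ (p ^ k) (≡.subst (_∣ c * p ^ k) ord≡ (↑≈ε⇒ord∣ g _
      (trans (↑-* g c (p ^ k)) (trans (↑-↑-comm g c (p ^ k)) (trans (sym (y↑p*≈ (p ^ k))) y↑p^1+k≈ε))))))
    g∈⟨y⟩ : g ∈⟨ y ⟩
    g∈⟨y⟩ = ∈⟨⟩-trans (coprime⇒∈⟨↑⟩ g↑p^1+k≈ε (coprime-^ (¬∣⇒coprime p-prime p∤c) (suc k)))
                      (∈⟨⟩-resp y↑p≈g↑c (↑∈⟨⟩ y p))

  module _ {p x} (p-prime : Prime p) (Ω : GeneratesΩ₁ p x) where
    private
      instance _ = prime⇒nonZero p-prime

    ord≡p : ord x ≡ p ^ 1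
    ord≡p = ord≡p^suc p-prime 0
      (trans (↑-congʳ x (ℕ.*-identityʳ p)) x↑p≈ε) (x≉ε ∘ trans (sym (identityʳ x)))
      where open GeneratesΩ₁ Ω

    -- Each step finds y ∉ ⟨g⟩ with y ↑ p ∈ ⟨g⟩; y ↑ p cannot be a p-th power in ⟨g⟩ since Ω₁ ⊆ ⟨g⟩.
    tower : ∀ k → p ^ suc k ∣ n → ∃ λ g → ord g ≡ p ^ suc k × x ∈⟨ g ⟩
    tower zero _ = x , ord≡p , g∈⟨g⟩ x
    tower (suc k) p^2+k∣n with tower k (∣-trans (n∣m*n p) p^2+k∣n)
    ... | g , ord≡ , x∈⟨g⟩ with cauchy-quotient ⟨ g ⟩ p-prime (≡.subst (_∣ n) size*p≡ p^2+k∣n)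
      where
      size*p≡ : p ^ suc (suc k) ≡ size ⟨ g ⟩ * p
      size*p≡ = ≡.trans (ℕ.*-comm p (p ^ suc k)) (≡.cong (_* p) (≡.sym (≡.trans (size⟨⟩ g) ord≡)))
    ... | y , y∉⟨g⟩ , y↑p∈⟨g⟩ with ∈ₛ⇒∈⟨⟩ y↑p∈⟨g⟩
    ... | c , y↑p≈g↑c with p ∣? c
    ... | yes (divides d ≡.refl) = contradiction (∈⟨⟩⇒∈ₛ y∈⟨g⟩) y∉⟨g⟩
      where
      y∈⟨g⟩ : y ∈⟨ g ⟩
      y∈⟨g⟩ = Ω₁⊆⟨g⟩⇒root∈⟨g⟩ Ω x∈⟨g⟩ (↑∈⟨⟩ g d) (trans y↑p≈g↑c (↑-* g d p))
    ... | no p∤c with root-of-generator p-prime k ord≡ y↑p≈g↑c p∤c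
    ...   | ord-y≡ , g∈⟨y⟩ = y , ord-y≡ , ∈⟨⟩-trans x∈⟨g⟩ g∈⟨y⟩

    Ω₁⇒p∣n : p ∣ n
    Ω₁⇒p∣n = ≡.subst (_∣ n) (≡.trans ord≡p (ℕ.*-identityʳ p)) (ord∣n x)

    Ω₁⇒cyclicSylow : Σ (Carrier → Set (c ⊔ ℓ)) λ P → IsSylow G p n P × IsCyclicSubgroup G P
    Ω₁⇒cyclicSylow with exact-prime-power p-prime n {{ℕ.>-nonZero (size≤n trivial)}}
    ... | zero  , _ , p^1∤n = contradiction (≡.subst (_∣ n) (≡.sym (ℕ.*-identityʳ p)) Ω₁⇒p∣n) p^1∤n
    ... | suc k , p^a∣n , p^suc-a∤n with tower k p^a∣n
    ...   | g , ord≡ , _ =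
      ⟦ ⟨ g ⟩ ⟧ ,
      (⟦⟧-isSubgroup ⟨ g ⟩ , suc k ,
       ≡.subst (HasSize G ⟦ ⟨ g ⟩ ⟧) (≡.trans (size⟨⟩ g) ord≡) (⟦⟧-hasSize ⟨ g ⟩) ,
       p^a∣n , p^suc-a∤n) ,
      (g , lift (y∈adjoin trivial g) , λ _ (lift h∈) → ∈ₛ⇒∈⟨⟩ h∈)

theorem3p2 : ∀ {c ℓ : Level} (G : AbelianGroup c ℓ) (n : ℕ) → HasOrder G n →
    (∃ λ x → IsConeVertex G x) ⇔
    (∃ λ p → Prime p × (p ∣ n) ×
      Σ (AbelianGroup.Carrier G → Set (c ⊔ ℓ)) λ P → IsSylow G p n P × IsCyclicSubgroup G P)
theorem3p2 {c} {ℓ} G n order = mk⇔ cone⇒cyclicSylow cyclicSylow⇒cone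
  where
  open AbelianGroup G using (Carrier)
  open Finite G order

  CyclicSylow : Set (lsuc (c ⊔ ℓ))
  CyclicSylow = ∃ λ p → Prime p × (p ∣ n) ×
    Σ (Carrier → Set (c ⊔ ℓ)) λ P → IsSylow G p n P × IsCyclicSubgroup G P

  cone⇒cyclicSylow : (∃ λ x → IsConeVertex G x) → CyclicSylow
  cone⇒cyclicSylow (_ , cone) with cone⇒Ω₁ cone
  ... | p , p-prime , _ , Ω = p , p-prime , Ω₁⇒p∣n p-prime Ω , Ω₁⇒cyclicSylow p-prime Ω

  cyclicSylow⇒cone : CyclicSylow → ∃ λ x → IsConeVertex G x
  cyclicSylow⇒cone (p , p-prime , p∣n , _ , sylow , cyclic)
    with cyclicSylow⇒Ω₁ p-prime p∣n sylow cyclic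
  ... | x , Ω = x , Ω₁⇒cone p-prime Ω
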